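{- Let $h\ge 2$, $w=2h+1$, and let $n\in A_w$ have parameters $p(n)=(\alpha^1,\dots,\alpha^h)$ satisfying $0<\alpha^1\le 5$, $\alpha^1\ge\alpha^2+1$, $\alpha^s+\alpha^{s+1}\le 9$ for $1\le s\le h-1$, $\alpha^{h-1}\ge 1$ and $1<\alpha^h<5$. Then $p(K(n))=(10-\alpha^h,\ 9-\alpha^h-\alpha^{h-1},\ \dots,\ 9-\alpha^3-\alpha^2,\ 9-\alpha^2-\alpha^1)$, i.e. the first parameter of $K(n)$ is $10-\alpha^h$ and the $s$-th is $9-\alpha^{h+2-s}-\alpha^{h+1-s}$ for $2\le s\le h$.
   Context: A $w$-digit number is a string of $w$ decimal digits (leading zeros allowed); $A_w$ is the set of those whose digits are not all identical. For a $w$-digit number $n$, $O_d(n)=x_1\dots x_w$ is obtained by sorting its digits in non-increasing order and $O_u(n)=x_w\dots x_1$ by sorting them in non-decreasing order; the Kaprekar map is $K(n)=O_d(n)-O_u(n)$, written as a $w$-digit string with leading zeros. With $h=\lfloor w/2\rfloor$, the parameters of a $w$-digit number $n$ are $p(n)=(\alpha^1,\dots,\alpha^h)$, $\alpha^s=x_s-x_{w-s+1}$ where $x_1\ge\dots\ge x_w$ are its sorted digits. -}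

module Defs where

open import Data.Nat using (ℕ; zero; suc; _+_; _*_; _∸_; _^_; _≤ᵇ_)
open import Data.Nat.DivMod using (_mod_; _/_)
open import Data.Fin using (Fin; toℕ)
open import Data.Vec using (Vec; []; _∷_; _∷ʳ_; map; reverse)
open import Data.Bool using (if_then_else_)
open import Relation.Binary.PropositionalEquality using (_≡_)
open import Relation.Nullary using (¬_)
open import Data.Product using (Σ)

-- A w-digit number: a string of w decimal digits, most significant first
-- (leading zeros allowed).
Digits : ℕ → Set
Digits w = Vec (Fin 10) w

AllSame : ∀ {w} → Digits w → Set
AllSame {w} n = Σ (Fin 10) (λ c → n ≡ Data.Vec.replicate w c)

InA : ∀ {w} → Digits w → Set
InA n = ¬ AllSame n

insertDesc : ∀ {m} → ℕ → Vec ℕ m → Vec ℕ (suc m)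
insertDesc x [] = x ∷ []
insertDesc x (y ∷ ys) = if y ≤ᵇ x then x ∷ y ∷ ys else y ∷ insertDesc x ys

sortDesc : ∀ {m} → Vec ℕ m → Vec ℕ m
sortDesc [] = []
sortDesc (x ∷ xs) = insertDesc x (sortDesc xs)

Od : ∀ {w} → Digits w → Vec ℕ w
Od n = sortDesc (map toℕ n)

Ou : ∀ {w} → Digits w → Vec ℕ w
Ou n = reverse (Od n)

value : ∀ {m} → Vec ℕ m → ℕ
value [] = 0
value {suc m} (d ∷ ds) = d * 10 ^ m + value ds

-- the w-digit string (with leading zeros) of a number m < 10^w
toDigits : (w : ℕ) → ℕ → Digits w
toDigits zero m = []
toDigits (suc w) m = toDigits w (m / 10) ∷ʳ (m mod 10)

K : ∀ {w} → Digits w → Digits w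
K {w} n = toDigits w (value (Od n) ∸ value (Ou n))

-- (default-0) access to position i (0-based) of a vector
at : ∀ {m} → Vec ℕ m → ℕ → ℕ
at [] i = 0
at (x ∷ xs) zero = x
at (x ∷ xs) (suc i) = at xs i

-- the s-th parameter (1-based, 1 ≤ s ≤ ⌊w/2⌋) of a w-digit number:
-- α^s = x_s − x_{w−s+1}, where x_1 ≥ … ≥ x_w are its sorted digits
-- (the subtraction is non-negative since the digits are sorted).
param : ∀ {w} → Digits w → ℕ → ℕ
param {w} n s = at (Od n) (s ∸ 1) ∸ at (Od n) (w ∸ s)

-- Write the sorted digits of n as u m r with |u| = |r| = h; the parameter list is then
-- α = u − reverse r, digitwise. In O_d(n) − O_u(n) the middle digit and the common part
-- reverse r cancel, leaving α·10^(h+1) − reverse α. Since 5 ≥ α¹ > α² ≥ … ≥ αʰ ≥ 1, this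
-- subtraction borrows in a fixed pattern and K(n) has the digits
--   α¹ α² … α^(h−1) (αʰ−1) 9 (9−αʰ) … (9−α²) (10−α¹),
-- the first h of them ≤ 5 and the last h+1 ≥ 5. Sorting K(n) just swaps these two blocks,
-- and the parameters of K(n) are read off from the swapped list.
module Submission where

open import Defs
open import Data.Bool using (true; false; if_then_else_)
open import Data.Fin using (toℕ)
open import Data.Fin.Properties using (toℕ-fromℕ<)
open import Data.List using (List; []; _∷_; _++_; [_]; length; map; reverse; zipWith; initLast; _∷ʳ′_)
open import Data.List.Properties
  using (length-++; length-map; length-zipWith; length-reverse; map-++; ++-identityʳ; ++-assoc;
         unfold-reverse; reverse-++; reverse-involutive)
open import Data.List.Relation.Binary.Permutation.Propositional using (↭-sym)
open import Data.List.Relation.Binary.Permutation.Propositional.Properties using (All-resp-↭; ↭-reverse)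
open import Data.List.Relation.Binary.Pointwise as Pointwise using (Pointwise; []; _∷_; Pointwise-length)
open import Data.List.Relation.Unary.All as All using (All; []; _∷_)
import Data.List.Relation.Unary.All.Properties as Allₚ
open import Data.List.Relation.Unary.AllPairs as AllPairs using (AllPairs; []; _∷_)
import Data.List.Relation.Unary.AllPairs.Properties as AllPairsₚ
open import Data.Nat using (ℕ; zero; suc; _+_; _*_; _∸_; _^_; _⊓_; _≤_; _<_; _≥_; _≤ᵇ_; z≤n; s≤s; _/_; _%_)
open import Data.Nat.DivMod using (_mod_; m*n/n≡m; m<n⇒m/n≡0; +-distrib-/-∣ˡ; [m+kn]%n≡m%n; m<n⇒m%n≡m)
open import Data.Nat.Divisibility using (divides-refl)
open import Data.Nat.Properties
open import Data.Nat.Tactic.RingSolver using (solve-∀)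
open import Data.Product using (_×_; _,_; Σ-syntax)
open import Data.Sum using (inj₁; inj₂)
open import Data.Vec as Vec using (Vec)
open import Data.Vec.Properties using (toList-map; toList-∷ʳ; toList-reverse; length-toList)
open import Function using (flip; _$_)
open import Relation.Binary.PropositionalEquality hiding ([_])
open import Relation.Nullary using (contradiction)
open import Relation.Nullary.Reflects using (ofʸ; ofⁿ)

-- Digit lists

-- List counterparts of insertDesc, sortDesc, at, value, toDigits and param from Defs.
insert≥ : ℕ → List ℕ → List ℕ
insert≥ x [] = [ x ]
insert≥ x (y ∷ ys) = if y ≤ᵇ x then x ∷ y ∷ ys else y ∷ insert≥ x ys

sort≥ : List ℕ → List ℕ
sort≥ [] = []
sort≥ (x ∷ xs) = insert≥ x (sort≥ xs)

nth : List ℕ → ℕ → ℕ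
nth [] i = 0
nth (x ∷ xs) zero = x
nth (x ∷ xs) (suc i) = nth xs i

listValue : List ℕ → ℕ
listValue [] = 0
listValue (d ∷ ds) = d * 10 ^ length ds + listValue ds

toDigitList : ℕ → ℕ → List ℕ
toDigitList zero m = []
toDigitList (suc w) m = toDigitList w (m / 10) ++ [ m % 10 ]

parameter : ℕ → List ℕ → ℕ → ℕ
parameter w x s = nth x (s ∸ 1) ∸ nth x (w ∸ s)

-- K(n), computed from the digits x of n sorted non-increasingly.
kaprekar : ℕ → List ℕ → List ℕ
kaprekar w x = toDigitList w (listValue x ∸ listValue (reverse x))

2*h+1≡h+[1+h] : ∀ h → 2 * h + 1 ≡ h + suc h
2*h+1≡h+[1+h] = solve-∀

all-reverse : ∀ {A : Set} {P : A → Set} {xs} → All P xs → All P (reverse xs)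
all-reverse {xs = xs} = All-resp-↭ (↭-sym (↭-reverse xs))

reverse-++-∷ : ∀ {A : Set} (xs : List A) y ys → reverse (xs ++ y ∷ ys) ≡ reverse ys ++ y ∷ reverse xs
reverse-++-∷ xs y ys = begin
  reverse (xs ++ y ∷ ys)                 ≡⟨ reverse-++ xs (y ∷ ys) ⟩
  reverse (y ∷ ys) ++ reverse xs         ≡⟨ cong (_++ reverse xs) (unfold-reverse y ys) ⟩
  (reverse ys ++ [ y ]) ++ reverse xs    ≡⟨ ++-assoc (reverse ys) [ y ] (reverse xs) ⟩
  reverse ys ++ y ∷ reverse xs           ∎
  where open ≡-Reasoning

split-around : ∀ i j x → length x ≡ i + suc j →
  Σ[ u ∈ List ℕ ] Σ[ m ∈ ℕ ] Σ[ r ∈ List ℕ ] x ≡ u ++ m ∷ r × length u ≡ i × length r ≡ j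
split-around zero j (m ∷ r) eq = [] , m , r , refl , refl , suc-injective eq
split-around (suc i) j (y ∷ x) eq with split-around i j x (suc-injective eq)
... | u , m , r , x≡ , |u| , |r| = y ∷ u , m , r , cong (y ∷_) x≡ , cong suc |u| , |r|

split-first-last : ∀ xs → 2 ≤ length xs → Σ[ a ∈ ℕ ] Σ[ β ∈ List ℕ ] Σ[ c ∈ ℕ ] xs ≡ a ∷ β ++ [ c ]
split-first-last (a ∷ ys) 2≤ with initLast ys
... | [] = contradiction 2≤ λ { (s≤s ()) }
... | β ∷ʳ′ c = a , β , c , refl

nth-++ˡ : ∀ xs {ys i} → i < length xs → nth (xs ++ ys) i ≡ nth xs i
nth-++ˡ (x ∷ xs) {i = zero} _ = refl
nth-++ˡ (x ∷ xs) {i = suc i} (s≤s i<) = nth-++ˡ xs i<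

nth-++ʳ : ∀ xs {ys} j → nth (xs ++ ys) (length xs + j) ≡ nth ys j
nth-++ʳ [] j = refl
nth-++ʳ (x ∷ xs) j = nth-++ʳ xs j

nth-last : ∀ xs (x : ℕ) → nth (xs ++ [ x ]) (length xs) ≡ x
nth-last [] x = refl
nth-last (y ∷ xs) x = nth-last xs x

nth-reverse : ∀ xs {i} → i < length xs → nth (reverse xs) i ≡ nth xs (length xs ∸ suc i)
nth-reverse (x ∷ xs) {i} (s≤s i≤) rewrite unfold-reverse x xs with m≤n⇒m<n∨m≡n i≤
... | inj₁ i< = begin
  nth (reverse xs ++ [ x ]) i        ≡⟨ nth-++ˡ (reverse xs) (subst (i <_) (sym (length-reverse xs)) i<) ⟩
  nth (reverse xs) i                 ≡⟨ nth-reverse xs i< ⟩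
  nth xs (length xs ∸ suc i)         ≡⟨ cong (nth (x ∷ xs)) (+-∸-assoc 1 i<) ⟨
  nth (x ∷ xs) (length xs ∸ i)       ∎
  where open ≡-Reasoning
... | inj₂ refl = begin
  nth (reverse xs ++ [ x ]) (length xs)              ≡⟨ cong (nth (reverse xs ++ [ x ])) (length-reverse xs) ⟨
  nth (reverse xs ++ [ x ]) (length (reverse xs))    ≡⟨ nth-last (reverse xs) x ⟩
  x                                                  ≡⟨ cong (nth (x ∷ xs)) (n∸n≡0 (length xs)) ⟨
  nth (x ∷ xs) (length xs ∸ length xs)               ∎
  where open ≡-Reasoning

nth-map : ∀ f xs {i} → i < length xs → nth (map f xs) i ≡ f (nth xs i)
nth-map f (x ∷ xs) {zero} _ = refl
nth-map f (x ∷ xs) {suc i} (s≤s i<) = nth-map f xs i<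

nth-zipWith-∸ : ∀ xs ys i → length xs ≡ length ys → nth (zipWith _∸_ xs ys) i ≡ nth xs i ∸ nth ys i
nth-zipWith-∸ [] [] i _ = refl
nth-zipWith-∸ (x ∷ xs) (y ∷ ys) zero _ = refl
nth-zipWith-∸ (x ∷ xs) (y ∷ ys) (suc i) eq = nth-zipWith-∸ xs ys i (suc-injective eq)

zipWith-++ : ∀ (f : ℕ → ℕ → ℕ) xs ys {xs′ ys′} → length xs ≡ length ys →
  zipWith f (xs ++ xs′) (ys ++ ys′) ≡ zipWith f xs ys ++ zipWith f xs′ ys′
zipWith-++ f [] [] _ = refl
zipWith-++ f (x ∷ xs) (y ∷ ys) eq = cong (f x y ∷_) (zipWith-++ f xs ys (suc-injective eq))

reverse-zipWith : ∀ (f : ℕ → ℕ → ℕ) xs ys → length xs ≡ length ys →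
  reverse (zipWith f xs ys) ≡ zipWith f (reverse xs) (reverse ys)
reverse-zipWith f [] [] _ = refl
reverse-zipWith f (x ∷ xs) (y ∷ ys) eq = begin
  reverse (f x y ∷ zipWith f xs ys)
    ≡⟨ unfold-reverse (f x y) (zipWith f xs ys) ⟩
  reverse (zipWith f xs ys) ++ [ f x y ]
    ≡⟨ cong (_++ [ f x y ]) (reverse-zipWith f xs ys (suc-injective eq)) ⟩
  zipWith f (reverse xs) (reverse ys) ++ [ f x y ]
    ≡⟨ zipWith-++ f (reverse xs) (reverse ys) |rev| ⟨
  zipWith f (reverse xs ++ [ x ]) (reverse ys ++ [ y ])
    ≡⟨ cong₂ (zipWith f) (unfold-reverse x xs) (unfold-reverse y ys) ⟨
  zipWith f (reverse (x ∷ xs)) (reverse (y ∷ ys)) ∎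
  where
  open ≡-Reasoning
  |rev| : length (reverse xs) ≡ length (reverse ys)
  |rev| = trans (length-reverse xs) (trans (suc-injective eq) (sym (length-reverse ys)))

listValue-++ : ∀ xs ys → listValue (xs ++ ys) ≡ listValue xs * 10 ^ length ys + listValue ys
listValue-++ [] ys = refl
listValue-++ (d ∷ xs) ys
  rewrite length-++ xs {ys} | listValue-++ xs ys | ^-distribˡ-+-* 10 (length xs) (length ys) =
  shift d (10 ^ length xs) (10 ^ length ys) (listValue xs) (listValue ys)
  where
  shift : ∀ d P Q X Y → d * (P * Q) + (X * Q + Y) ≡ (d * P + X) * Q + Y
  shift = solve-∀

listValue-∷ʳ : ∀ xs d → listValue (xs ++ [ d ]) ≡ listValue xs * 10 + d
listValue-∷ʳ xs d = trans (listValue-++ xs [ d ])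
  (cong₂ _+_ (cong (listValue xs *_) (*-identityʳ 10)) (trans (+-identityʳ (d * 1)) (*-identityʳ d)))

[q*10+d]/10≡q : ∀ q {d} → d < 10 → (q * 10 + d) / 10 ≡ q
[q*10+d]/10≡q q {d} d<10 = begin
  (q * 10 + d) / 10       ≡⟨ +-distrib-/-∣ˡ d (divides-refl q) ⟩
  q * 10 / 10 + d / 10    ≡⟨ cong₂ _+_ (m*n/n≡m q 10) (m<n⇒m/n≡0 d<10) ⟩
  q + 0                   ≡⟨ +-identityʳ q ⟩
  q                       ∎
  where open ≡-Reasoning

[q*10+d]%10≡d : ∀ q {d} → d < 10 → (q * 10 + d) % 10 ≡ d
[q*10+d]%10≡d q {d} d<10 =
  trans (cong (_% 10) (+-comm (q * 10) d)) (trans ([m+kn]%n≡m%n d q 10) (m<n⇒m%n≡m d<10))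

toDigitList-listValue : ∀ ds → All (_< 10) ds → toDigitList (length ds) (listValue ds) ≡ ds
toDigitList-listValue ds ds<10 = begin
  toDigitList (length ds) (listValue ds)
    ≡⟨ cong₂ toDigitList (sym (length-reverse ds)) (cong listValue (sym (reverse-involutive ds))) ⟩
  toDigitList (length (reverse ds)) (listValue (reverse (reverse ds)))
    ≡⟨ reversed (reverse ds) (all-reverse ds<10) ⟩
  reverse (reverse ds)
    ≡⟨ reverse-involutive ds ⟩
  ds ∎
  where
  open ≡-Reasoning
  reversed : ∀ es → All (_< 10) es → toDigitList (length es) (listValue (reverse es)) ≡ reverse es
  reversed [] [] = refl
  reversed (e ∷ es) (e<10 ∷ es<10)
    rewrite unfold-reverse e es | listValue-∷ʳ (reverse es) e
          | [q*10+d]/10≡q (listValue (reverse es)) e<10 | [q*10+d]%10≡d (listValue (reverse es)) e<10 =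
    cong (_++ [ e ]) (reversed es es<10)

listValue-nines-complement : ∀ ds → All (_≤ 9) ds → listValue (map (9 ∸_) ds) + listValue ds + 1 ≡ 10 ^ length ds
listValue-nines-complement [] [] = refl
listValue-nines-complement (d ∷ ds) (d≤9 ∷ ds≤9) rewrite length-map (9 ∸_) ds = begin
  (9 ∸ d) * P + listValue (map (9 ∸_) ds) + (d * P + listValue ds) + 1
    ≡⟨ regroup (9 ∸ d) d P (listValue (map (9 ∸_) ds)) (listValue ds) ⟩
  (9 ∸ d + d) * P + (listValue (map (9 ∸_) ds) + listValue ds + 1)
    ≡⟨ cong₂ (λ n c → n * P + c) (m∸n+n≡m d≤9) (listValue-nines-complement ds ds≤9) ⟩
  9 * P + P
    ≡⟨ +-comm (9 * P) P ⟩
  10 * P ∎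
  where
  open ≡-Reasoning
  P = 10 ^ length ds
  regroup : ∀ e d P M X → e * P + M + (d * P + X) + 1 ≡ (e + d) * P + (M + X + 1)
  regroup = solve-∀

listValue-zipWith-∸ : ∀ {vs us} → Pointwise _≤_ vs us → listValue us ≡ listValue vs + listValue (zipWith _∸_ us vs)
listValue-zipWith-∸ [] = refl
listValue-zipWith-∸ {v ∷ vs} {u ∷ us} (v≤u ∷ vs≤us)
  rewrite length-zipWith _∸_ us vs | Pointwise-length vs≤us | ⊓-idem (length us) | listValue-zipWith-∸ vs≤us = begin
    u * P + (V + D)                 ≡⟨ cong (λ u → u * P + (V + D)) (m+[n∸m]≡n v≤u) ⟨
    (v + (u ∸ v)) * P + (V + D)     ≡⟨ regroup v (u ∸ v) P V D ⟩
    v * P + V + ((u ∸ v) * P + D)   ∎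
  where
  open ≡-Reasoning
  P = 10 ^ length us
  V = listValue vs
  D = listValue (zipWith _∸_ us vs)
  regroup : ∀ v a P V D → (v + a) * P + (V + D) ≡ v * P + V + (a * P + D)
  regroup = solve-∀

-- Sorting

Descending : List ℕ → Set
Descending = AllPairs _≥_

allPairs-++⁻ : ∀ {A : Set} {R : A → A → Set} xs {ys} → AllPairs R (xs ++ ys) →
  AllPairs R xs × AllPairs R ys × All (λ x → All (R x) ys) xs
allPairs-++⁻ [] rys = [] , rys , []
allPairs-++⁻ (x ∷ xs) (rx ∷ rxs) with allPairs-++⁻ xs rxs
... | rxs′ , rys , rxsys = (Allₚ.++⁻ˡ xs rx ∷ rxs′) , rys , (Allₚ.++⁻ʳ xs rx ∷ rxsys)

allPairs-reverse : ∀ {A : Set} {R : A → A → Set} {xs} → AllPairs R xs → AllPairs (flip R) (reverse xs)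
allPairs-reverse {xs = []} [] = []
allPairs-reverse {xs = x ∷ xs} (rx ∷ rxs) rewrite unfold-reverse x xs =
  AllPairsₚ.++⁺ (allPairs-reverse rxs) ([] ∷ []) (All.map (_∷ []) (all-reverse rx))

descending-≤-head : ∀ {xs} → Descending xs → All (_≤ nth xs 0) xs
descending-≤-head [] = []
descending-≤-head (x≥xs ∷ _) = ≤-refl ∷ x≥xs

insert≥-all : ∀ {P : ℕ → Set} {x} ys → P x → All P ys → All P (insert≥ x ys)
insert≥-all [] px [] = px ∷ []
insert≥-all {x = x} (y ∷ ys) px (py ∷ pys) with y ≤ᵇ x
... | true = px ∷ py ∷ pys
... | false = py ∷ insert≥-all ys px pys

insert≥-descending : ∀ x {ys} → Descending ys → Descending (insert≥ x ys)
insert≥-descending x [] = [] ∷ []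
insert≥-descending x {y ∷ ys} (y≥ys ∷ ys↓) with y ≤ᵇ x | ≤ᵇ-reflects-≤ y x
... | true | ofʸ y≤x = (y≤x ∷ All.map (λ z≤y → ≤-trans z≤y y≤x) y≥ys) ∷ y≥ys ∷ ys↓
... | false | ofⁿ y≰x = insert≥-all ys (≰⇒≥ y≰x) y≥ys ∷ insert≥-descending x ys↓

sort≥-descending : ∀ xs → Descending (sort≥ xs)
sort≥-descending [] = []
sort≥-descending (x ∷ xs) = insert≥-descending x (sort≥-descending xs)

∷-++-constant : ∀ {x : ℕ} ys {zs} → All (_≡ x) ys → x ∷ ys ++ zs ≡ ys ++ x ∷ zs
∷-++-constant [] [] = refl
∷-++-constant (y ∷ ys) (refl ∷ ys≡x) = cong (y ∷_) (∷-++-constant ys ys≡x)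

insert≥-between : ∀ x ys {zs} → Descending ys → All (x ≤_) ys → All (_≤ x) zs →
  insert≥ x (ys ++ zs) ≡ ys ++ x ∷ zs
insert≥-between x [] {[]} [] [] [] = refl
insert≥-between x [] {z ∷ _} [] [] (z≤x ∷ _) with z ≤ᵇ x | ≤ᵇ-reflects-≤ z x
... | true | _ = refl
... | false | ofⁿ z≰x = contradiction z≤x z≰x
insert≥-between x (y ∷ ys) {zs} (y≥ys ∷ ys↓) (x≤y ∷ x≤ys) x≥zs with y ≤ᵇ x | ≤ᵇ-reflects-≤ y x
... | true | ofʸ y≤x with ≤-antisym x≤y y≤x
...   | refl = cong (x ∷_) (∷-++-constant ys {zs} (All.zipWith (λ (z≤x , x≤z) → ≤-antisym z≤x x≤z) (y≥ys , x≤ys)))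
insert≥-between x (y ∷ ys) (y≥ys ∷ ys↓) (x≤y ∷ x≤ys) x≥zs | false | _ =
  cong (y ∷_) (insert≥-between x ys ys↓ x≤ys x≥zs)

sort≥-descending-id : ∀ {xs} → Descending xs → sort≥ xs ≡ xs
sort≥-descending-id [] = refl
sort≥-descending-id {x ∷ xs} (x≥xs ∷ xs↓) rewrite sort≥-descending-id xs↓ = insert≥-between x [] [] [] x≥xs

sort≥-++-swap : ∀ xs {ys} → Descending xs → Descending ys → All (λ x → All (x ≤_) ys) xs →
  sort≥ (xs ++ ys) ≡ ys ++ xs
sort≥-++-swap [] [] ys↓ [] = trans (sort≥-descending-id ys↓) (sym (++-identityʳ _))
sort≥-++-swap (x ∷ xs) (x≥xs ∷ xs↓) ys↓ (x≤ys ∷ xs≤ys) rewrite sort≥-++-swap xs xs↓ ys↓ xs≤ys =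
  insert≥-between x _ ys↓ x≤ys x≥xs

zipWith-∸-bounded : ∀ {p q us vs} → All (_≤ p) us → All (q ≤_) vs → All (_≤ p ∸ q) (zipWith _∸_ us vs)
zipWith-∸-bounded [] _ = []
zipWith-∸-bounded (_ ∷ _) [] = []
zipWith-∸-bounded (u≤p ∷ us≤p) (q≤v ∷ q≤vs) = ∸-mono u≤p q≤v ∷ zipWith-∸-bounded us≤p q≤vs

zipWith-∸-descending : ∀ {us vs} → Descending us → AllPairs _≤_ vs → Descending (zipWith _∸_ us vs)
zipWith-∸-descending [] _ = []
zipWith-∸-descending (_ ∷ _) [] = []
zipWith-∸-descending (u≥us ∷ us↓) (v≤vs ∷ vs↑) = zipWith-∸-bounded u≥us v≤vs ∷ zipWith-∸-descending us↓ vs↑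

pointwise-≤-from-All : ∀ {vs us} → length vs ≡ length us → All (λ u → All (_≤ u) vs) us → Pointwise _≤_ vs us
pointwise-≤-from-All {[]} {[]} _ _ = []
pointwise-≤-from-All {v ∷ vs} {u ∷ us} eq ((v≤u ∷ _) ∷ vs≤us) =
  v≤u ∷ pointwise-≤-from-All (suc-injective eq) (All.map (λ { (_ ∷ vs≤) → vs≤ }) vs≤us)

-- Parameters of a sorted list of odd length

parametersOf : List ℕ → List ℕ → List ℕ
parametersOf u r = zipWith _∸_ u (reverse r)

module MiddleSplit {u r : List ℕ} {m h : ℕ} (|u| : length u ≡ h) (|r| : length r ≡ h) where

  α : List ℕ
  α = parametersOf u r

  |u|≡|rev-r| : length u ≡ length (reverse r)
  |u|≡|rev-r| = trans |u| (trans (sym |r|) (sym (length-reverse r)))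

  |α| : length α ≡ h
  |α| = begin
    length (zipWith _∸_ u (reverse r))   ≡⟨ length-zipWith _∸_ u (reverse r) ⟩
    length u ⊓ length (reverse r)        ≡⟨ cong (_⊓ length (reverse r)) |u|≡|rev-r| ⟩
    length (reverse r) ⊓ length (reverse r) ≡⟨ ⊓-idem _ ⟩
    length (reverse r)                   ≡⟨ trans (length-reverse r) |r| ⟩
    h                                    ∎
    where open ≡-Reasoning

  rev-r≤u : Descending (u ++ m ∷ r) → Pointwise _≤_ (reverse r) u
  rev-r≤u x↓ with allPairs-++⁻ u x↓
  ... | _ , _ , u≥m∷r =
    pointwise-≤-from-All (sym |u|≡|rev-r|) (All.map (λ { (_ ∷ u≥r) → all-reverse u≥r }) u≥m∷r)

  α-descending : Descending (u ++ m ∷ r) → Descending α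
  α-descending x↓ with allPairs-++⁻ u x↓
  ... | u↓ , (_ ∷ r↓) , _ = zipWith-∸-descending u↓ (allPairs-reverse r↓)

  parameter-middle : ∀ s → 1 ≤ s → s ≤ h → parameter (2 * h + 1) (u ++ m ∷ r) s ≡ nth α (s ∸ 1)
  parameter-middle (suc s) _ s<h = begin
    nth (u ++ m ∷ r) s ∸ nth (u ++ m ∷ r) (2 * h + 1 ∸ suc s)
      ≡⟨ cong₂ _∸_ (nth-++ˡ u (subst (s <_) (sym |u|) s<h)) (cong (nth (u ++ m ∷ r)) mirror-index) ⟩
    nth u s ∸ nth (u ++ m ∷ r) (length u + suc (h ∸ suc s))
      ≡⟨ cong (nth u s ∸_) (nth-++ʳ u (suc (h ∸ suc s))) ⟩
    nth u s ∸ nth r (h ∸ suc s)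
      ≡⟨ cong (λ l → nth u s ∸ nth r (l ∸ suc s)) |r| ⟨
    nth u s ∸ nth r (length r ∸ suc s)
      ≡⟨ cong (nth u s ∸_) (nth-reverse r (subst (s <_) (sym |r|) s<h)) ⟨
    nth u s ∸ nth (reverse r) s
      ≡⟨ nth-zipWith-∸ u (reverse r) s |u|≡|rev-r| ⟨
    nth α s ∎
    where
    open ≡-Reasoning
    mirror-index : 2 * h + 1 ∸ suc s ≡ length u + suc (h ∸ suc s)
    mirror-index = begin
      2 * h + 1 ∸ suc s            ≡⟨ cong (_∸ suc s) (2*h+1≡h+[1+h] h) ⟩
      h + suc h ∸ suc s            ≡⟨ +-∸-assoc h (m≤n⇒m≤1+n s<h) ⟩
      h + (h ∸ s)                  ≡⟨ cong₂ _+_ (sym |u|) (+-∸-assoc 1 s<h) ⟩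
      length u + suc (h ∸ suc s)   ∎

  listValue-difference : Descending (u ++ m ∷ r) →
    listValue (u ++ m ∷ r) + listValue (reverse α) ≡ listValue (reverse (u ++ m ∷ r)) + listValue α * 10 ^ suc h
  listValue-difference x↓ = begin
    listValue (u ++ m ∷ r) + A′                ≡⟨ cong (_+ A′) value-x ⟩
    (V + A) * E + (m * H + V′) + A′            ≡⟨ regroup V A E (m * H) V′ A′ ⟩
    V * E + (m * H + (V′ + A′)) + A * E        ≡⟨ cong (_+ A * E) value-reverse-x ⟨
    listValue (reverse (u ++ m ∷ r)) + A * E   ∎
    where
    open ≡-Reasoning
    v = reverse r
    V = listValue v
    V′ = listValue (reverse v)
    A = listValue α
    A′ = listValue (reverse α)
    E = 10 ^ suc h
    H = 10 ^ h
    value-x : listValue (u ++ m ∷ r) ≡ (V + A) * E + (m * H + V′)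
    value-x = begin
      listValue (u ++ m ∷ r)
        ≡⟨ listValue-++ u (m ∷ r) ⟩
      listValue u * 10 ^ suc (length r) + (m * 10 ^ length r + listValue r)
        ≡⟨ cong₂ (λ U l → U * 10 ^ suc l + (m * 10 ^ l + listValue r)) (listValue-zipWith-∸ (rev-r≤u x↓)) |r| ⟩
      (V + A) * E + (m * H + listValue r)
        ≡⟨ cong (λ l → (V + A) * E + (m * H + listValue l)) (reverse-involutive r) ⟨
      (V + A) * E + (m * H + V′) ∎
    reversed-u : listValue (reverse u) ≡ V′ + A′
    reversed-u = trans (listValue-zipWith-∸ (Pointwise.reverse⁺ (rev-r≤u x↓)))
      (cong (λ l → V′ + listValue l) (sym (reverse-zipWith _∸_ u v |u|≡|rev-r|)))
    value-reverse-x : listValue (reverse (u ++ m ∷ r)) ≡ V * E + (m * H + (V′ + A′))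
    value-reverse-x = begin
      listValue (reverse (u ++ m ∷ r))
        ≡⟨ cong listValue (reverse-++-∷ u m r) ⟩
      listValue (v ++ m ∷ reverse u)
        ≡⟨ listValue-++ v (m ∷ reverse u) ⟩
      V * 10 ^ suc (length (reverse u)) + (m * 10 ^ length (reverse u) + listValue (reverse u))
        ≡⟨ cong₂ (λ l R → V * 10 ^ suc l + (m * 10 ^ l + R)) (trans (length-reverse u) |u|) reversed-u ⟩
      V * E + (m * H + (V′ + A′)) ∎
    regroup : ∀ V A E M V′ A′ → (V + A) * E + (M + V′) + A′ ≡ V * E + (M + (V′ + A′)) + A * E
    regroup = solve-∀

-- The digits of K(n)

module KaprekarDigits (a : ℕ) (β : List ℕ) (c : ℕ) where

  τ : List ℕ
  τ = β ++ [ c ]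

  α : List ℕ
  α = a ∷ τ

  small : List ℕ
  small = a ∷ β ++ [ c ∸ 1 ]

  complement : List ℕ
  complement = map (9 ∸_) (reverse τ)

  large : List ℕ
  large = 9 ∷ complement ++ [ 10 ∸ a ]

  |aβ| : length (a ∷ β) ≡ length τ
  |aβ| = trans (+-comm 1 (length β)) (sym (length-++ β))

  |small| : length small ≡ length α
  |small| = trans (length-++ (a ∷ β)) (sym (length-++ (a ∷ β)))

  |complement| : length complement ≡ length τ
  |complement| = trans (length-map (9 ∸_) (reverse τ)) (length-reverse τ)

  |complement++t| : length (complement ++ [ 10 ∸ a ]) ≡ suc (length τ)
  |complement++t| = trans (length-++ complement) (trans (+-comm (length complement) 1) (cong suc |complement|))

  listValue-digits : ∀ {h} → length α ≡ h → 1 ≤ c → a ≤ 10 → All (_≤ 9) τ →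
    listValue (reverse α) + listValue (small ++ large) ≡ listValue α * 10 ^ suc h
  -- Both sides carry an extra 10, so that a + (10 ∸ a) is cancelled after the semiring identity.
  listValue-digits refl c≥1 a≤10 τ≤9 = +-cancelʳ-≡ 10 _ _ (begin
    listValue (reverse α) + listValue (small ++ large) + 10
      ≡⟨ cong₂ (λ x y → x + y + 10) reversed-α (listValue-++ small large) ⟩
    R * 10 + a + (S * 10 ^ length large + listValue large) + 10
      ≡⟨ cong₂ (λ l L → R * 10 + a + (S * 10 ^ l + L) + 10) (cong suc |complement++t|) large-value ⟩
    R * 10 + a + (S * (10 * (10 * P)) + (9 * (10 * P) + (M * 10 + t))) + 10
      ≡⟨ cong (λ P → R * 10 + a + (S * (10 * (10 * P)) + (9 * (10 * P) + (M * 10 + t))) + 10) nines ⟨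
    R * 10 + a + (S * (10 * (10 * (M + R + 1))) + (9 * (10 * (M + R + 1)) + (M * 10 + t))) + 10
      ≡⟨ borrow R a S M t ⟩
    (S + 1) * (10 * (10 * (M + R + 1))) + (a + t)
      ≡⟨ cong₂ (λ A P → A * (10 * (10 * P)) + (a + t)) small-value nines ⟩
    listValue α * 10 ^ suc (length α) + (a + t)
      ≡⟨ cong (listValue α * 10 ^ suc (length α) +_) (m+[n∸m]≡n a≤10) ⟩
    listValue α * 10 ^ suc (length α) + 10 ∎)
    where
    open ≡-Reasoning
    R = listValue (reverse τ)
    S = listValue small
    M = listValue complement
    P = 10 ^ length τ
    t = 10 ∸ a
    reversed-α : listValue (reverse α) ≡ R * 10 + a
    reversed-α = trans (cong listValue (unfold-reverse a τ)) (listValue-∷ʳ (reverse τ) a)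
    large-value : listValue large ≡ 9 * (10 * P) + (M * 10 + t)
    large-value = cong₂ (λ l L → 9 * 10 ^ l + L) |complement++t| (listValue-∷ʳ complement t)
    nines : M + R + 1 ≡ P
    nines = trans (listValue-nines-complement (reverse τ) (all-reverse τ≤9)) (cong (10 ^_) (length-reverse τ))
    small-value : S + 1 ≡ listValue α
    small-value = begin
      listValue ((a ∷ β) ++ [ c ∸ 1 ]) + 1   ≡⟨ cong (_+ 1) (listValue-∷ʳ (a ∷ β) (c ∸ 1)) ⟩
      listValue (a ∷ β) * 10 + (c ∸ 1) + 1   ≡⟨ +-assoc (listValue (a ∷ β) * 10) (c ∸ 1) 1 ⟩
      listValue (a ∷ β) * 10 + (c ∸ 1 + 1)   ≡⟨ cong (listValue (a ∷ β) * 10 +_) (m∸n+n≡m c≥1) ⟩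
      listValue (a ∷ β) * 10 + c             ≡⟨ listValue-∷ʳ (a ∷ β) c ⟨
      listValue α                            ∎
    borrow : ∀ R a S M t → R * 10 + a + (S * (10 * (10 * (M + R + 1))) + (9 * (10 * (M + R + 1)) + (M * 10 + t))) + 10
                         ≡ (S + 1) * (10 * (10 * (M + R + 1))) + (a + t)
    borrow = solve-∀

  module Sorting (α↓ : Descending α) (a≥1 : 1 ≤ a) (a≤5 : a ≤ 5) (τ<a : All (_< a) τ) where

    τ≤4 : All (_≤ 4) τ
    τ≤4 = All.map (λ z<a → ≤-pred (≤-trans z<a a≤5)) τ<a

    small↓ : Descending small
    small↓ with allPairs-++⁻ (a ∷ β) α↓
    ... | aβ↓ , _ , aβ≥c =
      AllPairsₚ.++⁺ aβ↓ ([] ∷ []) (All.map (λ { (c≤z ∷ []) → ≤-trans (m∸n≤m c 1) c≤z ∷ [] }) aβ≥c)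

    small≤5 : All (_≤ 5) small
    small≤5 = All.map (λ z≤a → ≤-trans z≤a a≤5) (≤-refl ∷ AllPairs.head small↓)

    t≤9 : 10 ∸ a ≤ 9
    t≤9 = ∸-monoʳ-≤ 10 a≥1

    complement≤9 : All (_≤ 9) complement
    complement≤9 = Allₚ.map⁺ (All.universal (λ z → m∸n≤m 9 z) (reverse τ))

    complement↓ : Descending complement
    complement↓ = AllPairsₚ.map⁺ (AllPairs.map (∸-monoʳ-≤ 9) (allPairs-reverse (AllPairs.tail α↓)))

    large↓ : Descending large
    large↓ = Allₚ.++⁺ complement≤9 (t≤9 ∷ [])
           ∷ AllPairsₚ.++⁺ complement↓ ([] ∷ [])
               (Allₚ.map⁺ (All.map (λ z<a → ∸-monoʳ-≤ 10 z<a ∷ []) (all-reverse τ<a)))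

    large≥5 : All (5 ≤_) large
    large≥5 = m≤m+n 5 4
            ∷ Allₚ.++⁺ (Allₚ.map⁺ (All.map (∸-monoʳ-≤ 9) (all-reverse τ≤4))) (∸-monoʳ-≤ 10 a≤5 ∷ [])

    digits<10 : All (_< 10) (small ++ large)
    digits<10 = Allₚ.++⁺ (All.map (λ z≤5 → s≤s (≤-trans z≤5 (m≤m+n 5 4))) small≤5)
                         (All.map s≤s (≤-refl ∷ Allₚ.++⁺ complement≤9 (t≤9 ∷ [])))

    sort≥-digits : sort≥ (small ++ large) ≡ large ++ small
    sort≥-digits =
      sort≥-++-swap small small↓ large↓ (All.map (λ z≤5 → All.map (≤-trans z≤5) large≥5) small≤5)

  large++small : large ++ small ≡ (9 ∷ complement) ++ (10 ∸ a) ∷ small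
  large++small = cong (9 ∷_) (++-assoc complement [ 10 ∸ a ] small)

  open MiddleSplit {9 ∷ complement} {small} {10 ∸ a} (cong suc |complement|) |small|
    renaming (α to α′) using (parameter-middle; |u|≡|rev-r|)

  nth-α′ : ∀ i → nth α′ i ≡ nth (9 ∷ complement) i ∸ nth ((c ∸ 1) ∷ reverse (a ∷ β)) i
  nth-α′ i = trans (nth-zipWith-∸ (9 ∷ complement) (reverse small) i |u|≡|rev-r|)
                   (cong (λ l → nth (9 ∷ complement) i ∸ nth l i) (reverse-++ (a ∷ β) [ c ∸ 1 ]))

  parameter-first : ∀ {h} → length α ≡ h → 1 ≤ c → parameter (2 * h + 1) (large ++ small) 1 ≡ 10 ∸ c
  parameter-first refl c≥1 = begin
    parameter (2 * length α + 1) (large ++ small) 1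
      ≡⟨ cong (λ l → parameter (2 * length α + 1) l 1) large++small ⟩
    parameter (2 * length α + 1) ((9 ∷ complement) ++ (10 ∸ a) ∷ small) 1
      ≡⟨ parameter-middle 1 ≤-refl (s≤s z≤n) ⟩
    nth α′ 0
      ≡⟨ nth-α′ 0 ⟩
    9 ∸ (c ∸ 1)
      ≡⟨ borrowed c≥1 ⟩
    10 ∸ c ∎
    where
    open ≡-Reasoning
    borrowed : ∀ {c} → 1 ≤ c → 9 ∸ (c ∸ 1) ≡ 10 ∸ c
    borrowed (s≤s _) = refl

  parameter-later : ∀ {h} → length α ≡ h → ∀ s → 2 ≤ s → s ≤ h →
    parameter (2 * h + 1) (large ++ small) s ≡ 9 ∸ (nth α (h + 1 ∸ s) + nth α (h ∸ s))
  parameter-later refl (suc (suc j)) (s≤s (s≤s _)) (s≤s j<g) = begin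
    parameter (2 * length α + 1) (large ++ small) (suc (suc j))
      ≡⟨ cong (λ l → parameter (2 * length α + 1) l (suc (suc j))) large++small ⟩
    parameter (2 * length α + 1) ((9 ∷ complement) ++ (10 ∸ a) ∷ small) (suc (suc j))
      ≡⟨ parameter-middle (suc (suc j)) (s≤s z≤n) (s≤s j<g) ⟩
    nth α′ (suc j)
      ≡⟨ nth-α′ (suc j) ⟩
    nth complement j ∸ nth (reverse (a ∷ β)) j
      ≡⟨ cong₂ _∸_ (nth-map (9 ∸_) (reverse τ) (subst (j <_) (sym (length-reverse τ)) j<g))
                   (nth-reverse (a ∷ β) (subst (j <_) (sym |aβ|) j<g)) ⟩
    9 ∸ nth (reverse τ) j ∸ nth (a ∷ β) (length (a ∷ β) ∸ suc j)
      ≡⟨ cong₂ (λ x y → 9 ∸ x ∸ y) (nth-reverse τ j<g) (cong (λ l → nth (a ∷ β) (l ∸ suc j)) |aβ|) ⟩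
    9 ∸ nth τ (length τ ∸ suc j) ∸ nth (a ∷ β) (length τ ∸ suc j)
      ≡⟨ cong (9 ∸ nth τ (length τ ∸ suc j) ∸_)
              (nth-++ˡ (a ∷ β) (subst (length τ ∸ suc j <_) (sym |aβ|) (∸-< j<g))) ⟨
    9 ∸ nth α (suc (length τ ∸ suc j)) ∸ nth α (length τ ∸ suc j)
      ≡⟨ ∸-+-assoc 9 (nth α (suc (length τ ∸ suc j))) (nth α (length τ ∸ suc j)) ⟩
    9 ∸ (nth α (suc (length τ ∸ suc j)) + nth α (length τ ∸ suc j))
      ≡⟨ cong (λ i → 9 ∸ (nth α i + nth α (length τ ∸ suc j))) (trans (+-∸-comm 1 j<g) (+-comm _ 1)) ⟨
    9 ∸ (nth α (length τ + 1 ∸ suc j) + nth α (length τ ∸ suc j)) ∎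
    where
    open ≡-Reasoning
    ∸-< : ∀ {j g} → suc j ≤ g → g ∸ suc j < g
    ∸-< {j} {suc g} _ = s≤s (m∸n≤m g j)

ParameterRule : ℕ → (ℕ → ℕ) → (ℕ → ℕ) → Set
ParameterRule h p q =
  (q 1 ≡ 10 ∸ p h) × (∀ s → 2 ≤ s → s ≤ h → q s ≡ 9 ∸ (p (h + 2 ∸ s) + p (h + 1 ∸ s)))

ParameterRule-cong : ∀ {h p p′ q q′} → (∀ s → p s ≡ p′ s) → (∀ s → q s ≡ q′ s) →
  ParameterRule h p q → ParameterRule h p′ q′
ParameterRule-cong {h} p≗ q≗ (first , later) =
  trans (sym (q≗ 1)) (trans first (cong (10 ∸_) (p≗ h))) ,
  λ s 2≤s s≤h → trans (sym (q≗ s))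
    (trans (later s 2≤s s≤h) (cong₂ (λ i j → 9 ∸ (i + j)) (p≗ (h + 2 ∸ s)) (p≗ (h + 1 ∸ s))))

module SortedDigits {u r β : List ℕ} {m h a c : ℕ} (|u| : length u ≡ h) (|r| : length r ≡ h)
  (x↓ : Descending (u ++ m ∷ r)) (α≡ : parametersOf u r ≡ a ∷ β ++ [ c ]) where

  open KaprekarDigits a β c
  open MiddleSplit {u} {r} {m} |u| |r| using (parameter-middle; α-descending; listValue-difference)
    renaming (|α| to |parametersOf|)

  x : List ℕ
  x = u ++ m ∷ r

  w : ℕ
  w = 2 * h + 1

  length-α : length α ≡ h
  length-α = trans (cong length (sym α≡)) |parametersOf|

  α↓ : Descending α
  α↓ = subst Descending α≡ (α-descending x↓)

  parameter-x : ∀ s → 1 ≤ s → s ≤ h → parameter w x s ≡ nth α (s ∸ 1)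
  parameter-x s 1≤s s≤h = trans (parameter-middle s 1≤s s≤h) (cong (λ l → nth l (s ∸ 1)) α≡)

  parameter-x-first : parameter w x 1 ≡ a
  parameter-x-first = parameter-x 1 ≤-refl (subst (1 ≤_) length-α (s≤s z≤n))

  parameter-x-second : 2 ≤ h → parameter w x 2 ≡ nth τ 0
  parameter-x-second = parameter-x 2 (s≤s z≤n)

  parameter-x-last : parameter w x h ≡ c
  parameter-x-last =
    trans (parameter-x h (subst (1 ≤_) length-α (s≤s z≤n)) ≤-refl) (trans (cong (nth α) last-index) (nth-last β c))
    where
    last-index : h ∸ 1 ≡ suc (length β)
    last-index = trans (cong (_∸ 1) (sym length-α)) (trans (length-++ β) (+-comm (length β) 1))

  parameter-x-mirror : ∀ k s → k < s → s ≤ h → parameter w x (h + suc k ∸ s) ≡ nth α (h + k ∸ s)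
  parameter-x-mirror k s k<s s≤h =
    trans (parameter-x (h + suc k ∸ s) lower upper)
          (cong (nth α) (trans (m∸n∸1≡m∸[1+n] (h + suc k) s) (cong (_∸ suc s) (+-suc h k))))
    where
    lower : 1 ≤ h + suc k ∸ s
    lower = m<n⇒0<n∸m (≤-<-trans s≤h (m<m+n h (s≤s z≤n)))
    upper : h + suc k ∸ s ≤ h
    upper = subst (h + suc k ∸ s ≤_) (m+n∸n≡m h (suc k)) (∸-monoʳ-≤ (h + suc k) k<s)
    m∸n∸1≡m∸[1+n] : ∀ m n → m ∸ n ∸ 1 ≡ m ∸ suc n
    m∸n∸1≡m∸[1+n] m n = trans (∸-+-assoc m n 1) (cong (m ∸_) (+-comm n 1))

  x-difference : listValue x + listValue (reverse α) ≡ listValue (reverse x) + listValue α * 10 ^ suc h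
  x-difference = subst (λ l → listValue x + listValue (reverse l) ≡ listValue (reverse x) + listValue l * 10 ^ suc h)
                       α≡ (listValue-difference x↓)

  module Bounded (a≥1 : 1 ≤ a) (a≤5 : a ≤ 5) (τ<a : All (_< a) τ) (c≥1 : 1 ≤ c) where
    open Sorting α↓ a≥1 a≤5 τ<a

    listValue-kaprekar : listValue x ∸ listValue (reverse x) ≡ listValue (small ++ large)
    listValue-kaprekar = trans (cong (_∸ listValue (reverse x)) x≡) (m+n∸m≡n (listValue (reverse x)) _)
      where
      open ≡-Reasoning
      +-comm-middle : ∀ p q r → p + (q + r) ≡ p + r + q
      +-comm-middle = solve-∀
      x≡ : listValue x ≡ listValue (reverse x) + listValue (small ++ large)
      x≡ = +-cancelʳ-≡ (listValue (reverse α)) _ _ (begin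
        listValue x + listValue (reverse α)
          ≡⟨ x-difference ⟩
        listValue (reverse x) + listValue α * 10 ^ suc h
          ≡⟨ cong (listValue (reverse x) +_) (listValue-digits length-α c≥1 (≤-trans a≤5 (m≤m+n 5 5))
                                                (All.map (λ z≤4 → ≤-trans z≤4 (m≤m+n 4 5)) τ≤4)) ⟨
        listValue (reverse x) + (listValue (reverse α) + listValue (small ++ large))
          ≡⟨ +-comm-middle (listValue (reverse x)) (listValue (reverse α)) (listValue (small ++ large)) ⟩
        listValue (reverse x) + listValue (small ++ large) + listValue (reverse α) ∎)

    |digits| : length (small ++ large) ≡ w
    |digits| = begin
      length (small ++ large)       ≡⟨ length-++ small ⟩
      length small + length large   ≡⟨ cong₂ _+_ |small| (cong suc |complement++t|) ⟩
      length α + suc (length α)     ≡⟨ cong (λ l → l + suc l) length-α ⟩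
      h + suc h                     ≡⟨ 2*h+1≡h+[1+h] h ⟨
      2 * h + 1                     ∎
      where open ≡-Reasoning

    sort≥-kaprekar : sort≥ (kaprekar w x) ≡ large ++ small
    sort≥-kaprekar = begin
      sort≥ (toDigitList w (listValue x ∸ listValue (reverse x)))
        ≡⟨ cong₂ (λ l n → sort≥ (toDigitList l n)) (sym |digits|) listValue-kaprekar ⟩
      sort≥ (toDigitList (length (small ++ large)) (listValue (small ++ large)))
        ≡⟨ cong sort≥ (toDigitList-listValue (small ++ large) digits<10) ⟩
      sort≥ (small ++ large)
        ≡⟨ sort≥-digits ⟩
      large ++ small ∎
      where open ≡-Reasoning

    kaprekar-parameter-first : parameter w (sort≥ (kaprekar w x)) 1 ≡ 10 ∸ c
    kaprekar-parameter-first = trans (cong (λ y → parameter w y 1) sort≥-kaprekar) (parameter-first length-α c≥1)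

    kaprekar-parameter-later : ∀ s → 2 ≤ s → s ≤ h →
      parameter w (sort≥ (kaprekar w x)) s ≡ 9 ∸ (nth α (h + 1 ∸ s) + nth α (h ∸ s))
    kaprekar-parameter-later s 2≤s s≤h =
      trans (cong (λ y → parameter w y s) sort≥-kaprekar) (parameter-later length-α s 2≤s s≤h)

  kaprekar-parameters : 2 ≤ h → 0 < parameter w x 1 → parameter w x 1 ≤ 5 →
    parameter w x 2 + 1 ≤ parameter w x 1 → 0 < parameter w x h →
    ParameterRule h (parameter w x) (parameter w (sort≥ (kaprekar w x)))
  kaprekar-parameters 2≤h 0<α¹ α¹≤5 α²<α¹ 0<αʰ =
    trans kaprekar-parameter-first (cong (10 ∸_) (sym parameter-x-last)) ,
    λ s 2≤s s≤h → trans (kaprekar-parameter-later s 2≤s s≤h)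
      (sym (cong₂ (λ i j → 9 ∸ (i + j)) (parameter-x-mirror 1 s 2≤s s≤h) (mirror-h+1 s 2≤s s≤h)))
    where
    mirror-h+1 : ∀ s → 2 ≤ s → s ≤ h → parameter w x (h + 1 ∸ s) ≡ nth α (h ∸ s)
    mirror-h+1 s 2≤s s≤h =
      trans (parameter-x-mirror 0 s (≤-trans (s≤s z≤n) 2≤s) s≤h) (cong (λ i → nth α (i ∸ s)) (+-identityʳ h))
    τ₀<a : nth τ 0 < a
    τ₀<a = subst (_≤ a) (+-comm (nth τ 0) 1) $
           subst₂ (λ α² α¹ → α² + 1 ≤ α¹) (parameter-x-second 2≤h) parameter-x-first α²<α¹
    open Bounded (subst (0 <_) parameter-x-first 0<α¹) (subst (_≤ 5) parameter-x-first α¹≤5)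
      (All.map (λ z≤τ₀ → ≤-<-trans z≤τ₀ τ₀<a) (descending-≤-head (AllPairs.tail α↓)))
      (subst (0 <_) parameter-x-last 0<αʰ)

kaprekar-parameters : ∀ h x → 2 ≤ h → length x ≡ 2 * h + 1 → Descending x →
  0 < parameter (2 * h + 1) x 1 → parameter (2 * h + 1) x 1 ≤ 5 →
  parameter (2 * h + 1) x 2 + 1 ≤ parameter (2 * h + 1) x 1 → 0 < parameter (2 * h + 1) x h →
  ParameterRule h (parameter (2 * h + 1) x) (parameter (2 * h + 1) (sort≥ (kaprekar (2 * h + 1) x)))
kaprekar-parameters h x 2≤h |x| x↓ with split-around h h x (trans |x| (2*h+1≡h+[1+h] h))
... | u , m , r , refl , |u| , |r|
  with split-first-last (parametersOf u r) (subst (2 ≤_) (sym (MiddleSplit.|α| {u} {r} {m} |u| |r|)) 2≤h)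
... | a , β , c , α≡ = SortedDigits.kaprekar-parameters {u} {r} {β} {m} |u| |r| x↓ α≡ 2≤h

-- From digit vectors to digit lists

toList-insertDesc : ∀ {m} x (ys : Vec ℕ m) → Vec.toList (insertDesc x ys) ≡ insert≥ x (Vec.toList ys)
toList-insertDesc x Vec.[] = refl
toList-insertDesc x (y Vec.∷ ys) with y ≤ᵇ x
... | true = refl
... | false = cong (y ∷_) (toList-insertDesc x ys)

toList-sortDesc : ∀ {m} (xs : Vec ℕ m) → Vec.toList (sortDesc xs) ≡ sort≥ (Vec.toList xs)
toList-sortDesc Vec.[] = refl
toList-sortDesc (x Vec.∷ xs) = trans (toList-insertDesc x (sortDesc xs)) (cong (insert≥ x) (toList-sortDesc xs))

at≡nth-toList : ∀ {m} (xs : Vec ℕ m) i → at xs i ≡ nth (Vec.toList xs) i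
at≡nth-toList Vec.[] i = refl
at≡nth-toList (x Vec.∷ xs) zero = refl
at≡nth-toList (x Vec.∷ xs) (suc i) = at≡nth-toList xs i

value≡listValue-toList : ∀ {m} (xs : Vec ℕ m) → value xs ≡ listValue (Vec.toList xs)
value≡listValue-toList Vec.[] = refl
value≡listValue-toList {suc m} (x Vec.∷ xs) rewrite length-toList xs = cong (x * 10 ^ m +_) (value≡listValue-toList xs)

toList-toDigits : ∀ w m → Vec.toList (Vec.map toℕ (toDigits w m)) ≡ toDigitList w m
toList-toDigits zero m = refl
toList-toDigits (suc w) m = begin
    Vec.toList (Vec.map toℕ (toDigits w (m / 10) Vec.∷ʳ (m mod 10)))
  ≡⟨ toList-map toℕ _ ⟩
    map toℕ (Vec.toList (toDigits w (m / 10) Vec.∷ʳ (m mod 10)))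
  ≡⟨ cong (map toℕ) (toList-∷ʳ _ (toDigits w (m / 10))) ⟩
    map toℕ (Vec.toList (toDigits w (m / 10)) ++ [ m mod 10 ])
  ≡⟨ map-++ toℕ (Vec.toList (toDigits w (m / 10))) [ m mod 10 ] ⟩
    map toℕ (Vec.toList (toDigits w (m / 10))) ++ [ toℕ (m mod 10) ]
  ≡⟨ cong₂ (λ ds d → ds ++ [ d ]) (sym (toList-map toℕ _)) (toℕ-fromℕ< _) ⟩
    Vec.toList (Vec.map toℕ (toDigits w (m / 10))) ++ [ m % 10 ]
  ≡⟨ cong (_++ [ m % 10 ]) (toList-toDigits w (m / 10)) ⟩
    toDigitList w (m / 10) ++ [ m % 10 ]
  ∎
  where open ≡-Reasoning

param≡parameter : ∀ {w} (n : Digits w) s → param n s ≡ parameter w (Vec.toList (Od n)) s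
param≡parameter {w} n s = cong₂ _∸_ (at≡nth-toList (Od n) (s ∸ 1)) (at≡nth-toList (Od n) (w ∸ s))

Od-descending : ∀ {w} (n : Digits w) → Descending (Vec.toList (Od n))
Od-descending n = subst Descending (sym (toList-sortDesc (Vec.map toℕ n))) (sort≥-descending (Vec.toList (Vec.map toℕ n)))

toList-Od-K : ∀ {w} (n : Digits w) → Vec.toList (Od (K n)) ≡ sort≥ (kaprekar w (Vec.toList (Od n)))
toList-Od-K {w} n = begin
  Vec.toList (sortDesc (Vec.map toℕ (K n)))
    ≡⟨ toList-sortDesc (Vec.map toℕ (K n)) ⟩
  sort≥ (Vec.toList (Vec.map toℕ (K n)))
    ≡⟨ cong sort≥ (toList-toDigits w _) ⟩
  sort≥ (toDigitList w (value (Od n) ∸ value (Ou n)))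
    ≡⟨ cong₂ (λ p q → sort≥ (toDigitList w (p ∸ q))) (value≡listValue-toList (Od n))
             (trans (value≡listValue-toList (Vec.reverse (Od n))) (cong listValue (toList-reverse (Od n)))) ⟩
  sort≥ (kaprekar w (Vec.toList (Od n))) ∎
  where open ≡-Reasoning

mainTheorem8 : (h : ℕ) → 2 ≤ h → (n : Digits (2 * h + 1)) → InA n →
    0 < param n 1 → param n 1 ≤ 5 →
    param n 2 + 1 ≤ param n 1 →
    (∀ s → 1 ≤ s → s ≤ h ∸ 1 → param n s + param n (s + 1) ≤ 9) →
    1 ≤ param n (h ∸ 1) →
    1 < param n h → param n h < 5 →
    (param (K n) 1 ≡ 10 ∸ param n h)
    × (∀ s → 2 ≤ s → s ≤ h →
         param (K n) s ≡ 9 ∸ (param n (h + 2 ∸ s) + param n (h + 1 ∸ s)))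
mainTheorem8 h 2≤h n _ 0<α¹ α¹≤5 α²<α¹ _ _ 1<αʰ _ =
  ParameterRule-cong (λ s → sym (p s)) (λ s → sym (param-K s))
    (kaprekar-parameters h x 2≤h (length-toList (Od n)) (Od-descending n)
      (subst (0 <_) (p 1) 0<α¹) (subst (_≤ 5) (p 1) α¹≤5) (subst₂ (λ i j → i + 1 ≤ j) (p 2) (p 1) α²<α¹)
      (subst (0 <_) (p h) (<⇒≤ 1<αʰ)))
  where
  x : List ℕ
  x = Vec.toList (Od n)
  p : ∀ s → param n s ≡ parameter (2 * h + 1) x s
  p = param≡parameter n
  param-K : ∀ s → param (K n) s ≡ parameter (2 * h + 1) (sort≥ (kaprekar (2 * h + 1) x)) s
  param-K s = trans (param≡parameter (K n) s) (cong (λ y → parameter (2 * h + 1) y s) (toList-Od-K n))
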